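{- Let $n\ge 2$, $E=[n]$, $k\ge1$, and let $G_1\subsetneq\dots\subsetneq G_k$ be subsets of $E$ with $|G_k|\le n-2$. Then the bases of the chain product $M_{\mathcal{G}}=H_{G_1}\wedge\dots\wedge H_{G_k}$ are exactly the sets $B\subseteq E$ with $|B|=n-k$ and $|G_i\setminus B|\le i-1$ for all $i=1,\dots,k$.
   Context: For $G\subseteq E$ with $|G|\le n-2$, $H_G:=U_{|G|,G}\oplus U_{|E\setminus G|-1,E\setminus G}$ is the loopfree corank-one matroid on $E$ with coloop set $G$ ($U_{r,S}$ is the uniform matroid of rank $r$ on $S$). The matroid intersection is $M\wedge N:=(M^*\vee N^*)^*$, where $*$ is duality and $M\vee N$ is matroid union (independent sets $I\cup J$ with $I$ independent in $M$, $J$ independent in $N$). -}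

module Defs where

open import Data.Nat using (ℕ; zero; suc; _≤_; _∸_)
open import Data.Fin using (Fin; zero; suc; toℕ; fromℕ; inject₁)
open import Data.Fin.Subset using (Subset; _⊆_; _⊂_; _∩_; _∪_; _─_; ∁; ∣_∣)
open import Data.Product using (Σ; _×_; ∃)
open import Relation.Binary.PropositionalEquality using (_≡_)

-- A matroid on the ground set E = Fin n is given by its independence predicate.
Indep : ℕ → Set₁
Indep n = Subset n → Set

IsBasis : ∀ {n} → Indep n → Subset n → Set
IsBasis M B = M B × (∀ I → M I → B ⊆ I → I ≡ B)

U : ∀ {n} → ℕ → Subset n → Indep n
U r S I = I ⊆ S × ∣ I ∣ ≤ r

directSum : ∀ {n} → Subset n → Indep n → Indep n → Indep n
directSum S M N I = M (I ∩ S) × N (I ∩ ∁ S)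

H : ∀ {n} → Subset n → Indep n
H G = directSum G (U ∣ G ∣ G) (U (∣ ∁ G ∣ ∸ 1) (∁ G))

dual : ∀ {n} → Indep n → Indep n
dual M I = ∃ λ B → IsBasis M B × I ⊆ ∁ B

union : ∀ {n} → Indep n → Indep n → Indep n
union M N I = ∃ λ J → ∃ λ K → M J × N K × I ≡ J ∪ K

wedge : ∀ {n} → Indep n → Indep n → Indep n
wedge M N = dual (union (dual M) (dual N))

-- Chain product H_{G_1} ∧ ⋯ ∧ H_{G_k} (k = suc m, indices 0..m), bracketed from the left.
chainProduct : ∀ {n} (m : ℕ) → (Fin (suc m) → Subset n) → Indep n
chainProduct zero G = H (G zero)
chainProduct (suc m) G = wedge (chainProduct m (λ i → G (inject₁ i))) (H (G (fromℕ (suc m))))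

module Submission where

-- We describe bases through their complements (cobases).  Call A admissible for a chain
-- G_0 ⊂ ⋯ ⊂ G_m if |A| = m + 1 and |G_i ∩ A| ≤ i for every i.  The main claim
-- (chainProduct-cobases) is that, whenever |G_m| < n, the cobases of the chain product are
-- exactly the admissible sets; the theorem is this claim rewritten in terms of B = ∁ A.
--
-- Independence predicates are handled through the
-- sets that generate them: generic lemmas show that an equicardinal generating family is
-- the set of bases, that a dual is generated by the cobases, and that a union is generated
-- by unions of generators.  The cobases of H_g are the singletons {c} with c ∉ g, so in the
-- inductive step the cobases of M ∧ H_g are the maximal sets below some A ∪ {c} with A
-- admissible for the shorter chain and c ∉ g.  The combinatorial core (exchange) says that
-- these sets generate the same down-set as the admissible sets for the longer chain; adding
-- a fresh element to A uses the last tight constraint |G_t ∩ A| = t and the strictness of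
-- the chain (freshElement).

open import Defs
open import Data.Nat using (ℕ; suc; _≤_; _∸_)
open import Data.Fin using (Fin; toℕ; fromℕ; inject₁; suc)
open import Data.Fin.Subset using (Subset; _⊂_; _─_; ∣_∣)
open import Data.Product using (_×_)
open import Function.Bundles using (_⇔_)
open import Relation.Binary.PropositionalEquality using (_≡_)

open import Data.Nat using (zero; _<_; _+_; z≤n; s≤s) renaming (_≟_ to _≟ℕ_)
open import Data.Nat.Properties hiding (_≟_)
open import Data.Fin using (zero; _≟_)
open import Data.Fin.Properties using (toℕ-inject₁; toℕ-fromℕ; toℕ≤pred[n]; any?)
open import Data.Fin.Relation.Unary.Top using (View; view; ‵fromℕ; ‵inj₁)
open import Data.Fin.Subset
open import Data.Fin.Subset.Properties
open import Data.Vec using ([]; _∷_; here; there)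
open import Data.Product using (∃; ∃₂; _,_; proj₁; proj₂)
open import Data.Sum using (_⊎_; inj₁; inj₂)
open import Relation.Nullary using (¬_; yes; no; Dec; contradiction; ¬?)
open import Relation.Nullary.Decidable using (_×-dec_)
open import Function.Bundles using (mk⇔; Equivalence)
open import Relation.Binary.PropositionalEquality using (refl; sym; trans; cong; subst; subst₂; module ≡-Reasoning)
import Algebra.Lattice.Properties.BooleanAlgebra as BooleanAlgebraProperties

open Equivalence using (to; from)

private
  variable
    n k : ℕ

_∘⇔_ : ∀ {A B C : Set} → B ⇔ C → A ⇔ B → A ⇔ C
f ∘⇔ g = mk⇔ (λ a → to f (to g a)) (λ c → from g (from f c))

∁-involutive : (p : Subset n) → ∁ (∁ p) ≡ p
∁-involutive {n} = ¬-involutive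
  where open BooleanAlgebraProperties (∪-∩-booleanAlgebra n)

∣∁p∣≡k⇒∣p∣≡n∸k : (p : Subset n) → ∣ ∁ p ∣ ≡ k → ∣ p ∣ ≡ n ∸ k
∣∁p∣≡k⇒∣p∣≡n∸k {n} p refl = begin
  ∣ p ∣               ≡⟨ m∸[m∸n]≡n (∣p∣≤n p) ⟨
  n ∸ (n ∸ ∣ p ∣)     ≡⟨ cong (n ∸_) (∣∁p∣≡n∸∣p∣ p) ⟨
  n ∸ ∣ ∁ p ∣         ∎
  where open ≡-Reasoning

p─q≡p∩∁q : (p q : Subset n) → p ─ q ≡ p ∩ ∁ q
p─q≡p∩∁q []            []            = refl
p─q≡p∩∁q (inside  ∷ p) (inside  ∷ q) = cong (outside ∷_) (p─q≡p∩∁q p q)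
p─q≡p∩∁q (inside  ∷ p) (outside ∷ q) = cong (inside ∷_)  (p─q≡p∩∁q p q)
p─q≡p∩∁q (outside ∷ p) (inside  ∷ q) = cong (outside ∷_) (p─q≡p∩∁q p q)
p─q≡p∩∁q (outside ∷ p) (outside ∷ q) = cong (outside ∷_) (p─q≡p∩∁q p q)

∣p∪q∣+∣p∩q∣ : (p q : Subset n) → ∣ p ∪ q ∣ + ∣ p ∩ q ∣ ≡ ∣ p ∣ + ∣ q ∣
∣p∪q∣+∣p∩q∣ []            []            = refl
∣p∪q∣+∣p∩q∣ (inside  ∷ p) (inside  ∷ q) =
  cong suc (trans (+-suc _ _) (trans (cong suc (∣p∪q∣+∣p∩q∣ p q)) (sym (+-suc _ _))))
∣p∪q∣+∣p∩q∣ (inside  ∷ p) (outside ∷ q) = cong suc (∣p∪q∣+∣p∩q∣ p q)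
∣p∪q∣+∣p∩q∣ (outside ∷ p) (inside  ∷ q) = trans (cong suc (∣p∪q∣+∣p∩q∣ p q)) (sym (+-suc _ _))
∣p∪q∣+∣p∩q∣ (outside ∷ p) (outside ∷ q) = ∣p∪q∣+∣p∩q∣ p q

∣p-x∣ : ∀ {x : Fin n} {p} → x ∈ p → suc ∣ p - x ∣ ≡ ∣ p ∣
∣p-x∣ {x = zero}  {inside  ∷ p} here        = cong (λ q → suc ∣ q ∣) (p─⊥≡p p)
∣p-x∣ {x = suc x} {inside  ∷ p} (there x∈p) = cong suc (∣p-x∣ x∈p)
∣p-x∣ {x = suc x} {outside ∷ p} (there x∈p) = ∣p-x∣ x∈p

⊆∧∣≡∣⇒≡ : ∀ {p q : Subset n} → p ⊆ q → ∣ p ∣ ≡ ∣ q ∣ → p ≡ q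
⊆∧∣≡∣⇒≡ {p = p} {q} p⊆q ∣p∣≡∣q∣ = ⊆-antisym p⊆q q⊆p
  where
  q⊆p : q ⊆ p
  q⊆p {x} x∈q with x ∈? p
  ... | yes x∈p = x∈p
  ... | no  x∉p = contradiction (p⊂q⇒∣p∣<∣q∣ (p⊆q , x , x∈q , x∉p)) (<-irrefl ∣p∣≡∣q∣)

outsideElement : (p q : Subset n) → ∣ p ∩ q ∣ < ∣ q ∣ → ∃ λ x → x ∈ q × x ∉ p
outsideElement p q small with any? (λ x → (x ∈? q) ×-dec ¬? (x ∈? p))
... | yes found = found
... | no  none  = contradiction (p⊆q⇒∣p∣≤∣q∣ q⊆p∩q) (<⇒≱ small)
  where
  q⊆p∩q : q ⊆ p ∩ q
  q⊆p∩q {x} x∈q with x ∈? p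
  ... | yes x∈p = x∈p∩q⁺ (x∈p , x∈q)
  ... | no  x∉p = contradiction (x , x∈q , x∉p) none

missedElement : (p : Subset n) → ∣ p ∣ < n → ∃ λ x → x ∉ p
missedElement {n} p small with outsideElement p ⊤ small′
  where
  small′ : ∣ p ∩ ⊤ ∣ < ∣ ⊤ {n} ∣
  small′ = subst₂ _<_ (cong ∣_∣ (sym (∩-identityʳ p))) (sym (∣⊤∣≡n n)) small
... | x , _ , x∉p = x , x∉p

∣p∩⁅x⁆∣≡0 : ∀ {x : Fin n} {p} → x ∉ p → ∣ p ∩ ⁅ x ⁆ ∣ ≡ 0
∣p∩⁅x⁆∣≡0 {n} {x} {p} x∉p = trans (cong ∣_∣ (Empty-unique empty)) (∣⊥∣≡0 n)
  where
  empty : Empty (p ∩ ⁅ x ⁆)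
  empty (y , y∈p∩⁅x⁆) with x∈p∩q⁻ p ⁅ x ⁆ y∈p∩⁅x⁆
  ... | y∈p , y∈⁅x⁆ = x∉p (subst (_∈ p) (x∈⁅y⁆⇒x≡y x y∈⁅x⁆) y∈p)

∣p∪⁅x⁆∣ : ∀ {x : Fin n} {p} → x ∉ p → ∣ p ∪ ⁅ x ⁆ ∣ ≡ suc ∣ p ∣
∣p∪⁅x⁆∣ {x = x} {p} x∉p = begin
  ∣ p ∪ ⁅ x ⁆ ∣                        ≡⟨ +-identityʳ _ ⟨
  ∣ p ∪ ⁅ x ⁆ ∣ + 0                    ≡⟨ cong (∣ p ∪ ⁅ x ⁆ ∣ +_) (∣p∩⁅x⁆∣≡0 x∉p) ⟨
  ∣ p ∪ ⁅ x ⁆ ∣ + ∣ p ∩ ⁅ x ⁆ ∣        ≡⟨ ∣p∪q∣+∣p∩q∣ p ⁅ x ⁆ ⟩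
  ∣ p ∣ + ∣ ⁅ x ⁆ ∣                    ≡⟨ cong (∣ p ∣ +_) (∣⁅x⁆∣≡1 x) ⟩
  ∣ p ∣ + 1                            ≡⟨ +-comm ∣ p ∣ 1 ⟩
  suc ∣ p ∣                            ∎
  where open ≡-Reasoning

∣F∩[A∪⁅x⁆]∣ : (F A : Subset n) (x : Fin n) → ∣ F ∩ (A ∪ ⁅ x ⁆) ∣ ≤ ∣ F ∩ A ∣ + ∣ F ∩ ⁅ x ⁆ ∣
∣F∩[A∪⁅x⁆]∣ F A x = begin
  ∣ F ∩ (A ∪ ⁅ x ⁆) ∣                                         ≡⟨ cong ∣_∣ (∩-distribˡ-∪ F A ⁅ x ⁆) ⟩
  ∣ (F ∩ A) ∪ (F ∩ ⁅ x ⁆) ∣                                   ≤⟨ m≤m+n _ _ ⟩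
  ∣ (F ∩ A) ∪ (F ∩ ⁅ x ⁆) ∣ + ∣ (F ∩ A) ∩ (F ∩ ⁅ x ⁆) ∣      ≡⟨ ∣p∪q∣+∣p∩q∣ (F ∩ A) (F ∩ ⁅ x ⁆) ⟩
  ∣ F ∩ A ∣ + ∣ F ∩ ⁅ x ⁆ ∣                                   ∎
  where open ≤-Reasoning

Generates : Indep n → (Subset n → Set) → Set
Generates M P = ∀ I → M I ⇔ (∃ λ A → P A × I ⊆ A)

basesOfGenerated : ∀ {M : Indep n} {P : Subset n → Set} → Generates M P → (∀ A → P A → ∣ A ∣ ≡ k)
  → ∀ B → IsBasis M B ⇔ P B
basesOfGenerated {M = M} {P} gen size B = mk⇔ basis⇒P P⇒basis
  where
  basis⇒P : IsBasis M B → P B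
  basis⇒P (indep , maximal) with to (gen B) indep
  ... | A , pA , B⊆A = subst P (maximal A (from (gen A) (A , pA , ⊆-refl)) B⊆A) pA
  P⇒basis : P B → IsBasis M B
  P⇒basis pB = from (gen B) (B , pB , ⊆-refl) , maximal
    where
    maximal : ∀ I → M I → B ⊆ I → I ≡ B
    maximal I indep B⊆I with to (gen I) indep
    ... | A , pA , I⊆A = ⊆-antisym (subst (I ⊆_) (sym B≡A) I⊆A) B⊆I
      where
      B≡A : B ≡ A
      B≡A = ⊆∧∣≡∣⇒≡ (⊆-trans B⊆I I⊆A) (trans (size B pB) (sym (size A pA)))

dualGenerated : ∀ {M : Indep n} {R : Subset n → Set} → (∀ B → IsBasis M B ⇔ R (∁ B)) → Generates (dual M) R
dualGenerated {M = M} {R} bases I = mk⇔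
  (λ { (B , basis , I⊆∁B) → ∁ B , to (bases B) basis , I⊆∁B })
  (λ { (A , rA , I⊆A) → ∁ A , from (bases (∁ A)) (subst R (sym (∁-involutive A)) rA)
                             , subst (I ⊆_) (sym (∁-involutive A)) I⊆A })

dualBases : ∀ {M : Indep n} {R : Subset n → Set} → (∀ B → IsBasis M B ⇔ R B) → (∀ A → R A → ∣ A ∣ ≡ k)
  → ∀ B → IsBasis (dual M) B ⇔ R (∁ B)
dualBases {M = M} {R} bases size =
  basesOfGenerated (dualGenerated {R = λ A → R (∁ A)} bases′)
                   (λ A rA → ∣∁p∣≡k⇒∣p∣≡n∸k A (size (∁ A) rA))
  where
  bases′ : ∀ B → IsBasis M B ⇔ R (∁ (∁ B))
  bases′ B = subst (λ X → IsBasis M B ⇔ R X) (sym (∁-involutive B)) (bases B)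

unionGenerated : ∀ {M N : Indep n} {P Q : Subset n → Set} → Generates M P → Generates N Q
  → ∀ I → union M N I ⇔ (∃₂ λ A A₁ → P A × Q A₁ × I ⊆ A ∪ A₁)
unionGenerated {M = M} {N} {P} {Q} genM genN I = mk⇔ split join
  where
  split : union M N I → ∃₂ λ A A₁ → P A × Q A₁ × I ⊆ A ∪ A₁
  split (J , K , mJ , nK , refl) with to (genM J) mJ | to (genN K) nK
  ... | A , pA , J⊆A | A₁ , qA₁ , K⊆A₁ = A , A₁ , pA , qA₁ , J∪K⊆A∪A₁
    where
    J∪K⊆A∪A₁ : J ∪ K ⊆ A ∪ A₁
    J∪K⊆A∪A₁ x∈J∪K with x∈p∪q⁻ J K x∈J∪K
    ... | inj₁ x∈J = x∈p∪q⁺ (inj₁ (J⊆A x∈J))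
    ... | inj₂ x∈K = x∈p∪q⁺ (inj₂ (K⊆A₁ x∈K))
  join : (∃₂ λ A A₁ → P A × Q A₁ × I ⊆ A ∪ A₁) → union M N I
  join (A , A₁ , pA , qA₁ , I⊆A∪A₁) =
    I ∩ A , I ∩ A₁ , from (genM _) (A , pA , p∩q⊆q I A) , from (genN _) (A₁ , qA₁ , p∩q⊆q I A₁) ,
    trans (sym I∩[A∪A₁]≡I) (∩-distribˡ-∪ I A A₁)
    where
    I∩[A∪A₁]≡I : I ∩ (A ∪ A₁) ≡ I
    I∩[A∪A₁]≡I = ⊆-antisym (p∩q⊆p I _) (λ x∈I → x∈p∩q⁺ (x∈I , I⊆A∪A₁ x∈I))

SingletonOutside : Subset n → Subset n → Set
SingletonOutside g A = ∃ λ c → c ∉ g × A ≡ ⁅ c ⁆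

H-generated : (g : Subset n) → ∣ g ∣ < n → Generates (H g) (λ B → SingletonOutside g (∁ B))
H-generated {n} g g-small I = mk⇔ indep⇒below below⇒indep
  where
  ∁g-nonempty : 0 < ∣ ∁ g ∣
  ∁g-nonempty = subst (0 <_) (sym (∣∁p∣≡n∸∣p∣ g)) (m<n⇒0<n∸m g-small)

  indep⇒below : H g I → ∃ λ B → SingletonOutside g (∁ B) × I ⊆ B
  indep⇒below (_ , _ , small) with outsideElement I (∁ g) (≤-<-trans small (∸-monoʳ-< ≤-refl ∁g-nonempty))
  ... | c , c∈∁g , c∉I = ∁ ⁅ c ⁆ , (c , x∈∁p⇒x∉p c∈∁g , ∁-involutive ⁅ c ⁆) , I⊆∁⁅c⁆
    where
    I⊆∁⁅c⁆ : I ⊆ ∁ ⁅ c ⁆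
    I⊆∁⁅c⁆ x∈I = x∉p⇒x∈∁p (λ x∈⁅c⁆ → c∉I (subst (_∈ I) (x∈⁅y⁆⇒x≡y c x∈⁅c⁆) x∈I))

  below⇒indep : (∃ λ B → SingletonOutside g (∁ B) × I ⊆ B) → H g I
  below⇒indep (B , (c , c∉g , ∁B≡⁅c⁆) , I⊆B) =
    (p∩q⊆q I g , ∣p∩q∣≤∣q∣ I g) , p∩q⊆q I (∁ g) , small
    where
    I∩∁g⊆∁g-c : I ∩ ∁ g ⊆ ∁ g - c
    I∩∁g⊆∁g-c {x} x∈I∩∁g with x∈p∩q⁻ I (∁ g) x∈I∩∁g
    ... | x∈I , x∈∁g = x∈p∧x≢y⇒x∈p-y x∈∁g λ { refl →
      x∈p⇒x∉∁p (I⊆B x∈I) (subst (x ∈_) (sym ∁B≡⁅c⁆) (x∈⁅x⁆ x)) }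
    small : ∣ I ∩ ∁ g ∣ ≤ ∣ ∁ g ∣ ∸ 1
    small = ≤-trans (p⊆q⇒∣p∣≤∣q∣ I∩∁g⊆∁g-c) (≤-reflexive (cong (_∸ 1) (∣p-x∣ (x∉p⇒x∈∁p c∉g))))

H-cobases : (g : Subset n) → ∣ g ∣ < n → ∀ B → IsBasis (H g) B ⇔ SingletonOutside g (∁ B)
H-cobases {n} g g-small = basesOfGenerated (H-generated g g-small) size
  where
  size : ∀ B → SingletonOutside g (∁ B) → ∣ B ∣ ≡ n ∸ 1
  size B (c , _ , ∁B≡⁅c⁆) = ∣∁p∣≡k⇒∣p∣≡n∸k B (trans (cong ∣_∣ ∁B≡⁅c⁆) (∣⁅x⁆∣≡1 c))

StrictChain : (Fin (suc k) → Subset n) → Set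
StrictChain {k} F = ∀ (i : Fin k) → F (inject₁ i) ⊂ F (suc i)

chain-growth : (F : Fin (suc k) → Subset n) → StrictChain F
  → ∀ i j → toℕ i ≤ toℕ j → F i ⊆ F j × ∣ F i ∣ + toℕ j ≤ ∣ F j ∣ + toℕ i
chain-growth {zero}  F chain zero    zero    _         = ⊆-refl , ≤-refl
chain-growth {suc k} F chain zero    zero    _         = ⊆-refl , ≤-refl
chain-growth {suc k} F chain zero    (suc j) _
  with chain-growth (λ i → F (suc i)) (λ i → chain (suc i)) zero j z≤n
... | F₁⊆Fj , growth = ⊆-trans (p⊂q⇒p⊆q (chain zero)) F₁⊆Fj ,
  ≤-trans (≤-reflexive (+-suc _ (toℕ j))) (≤-trans (+-monoˡ-≤ (toℕ j) (p⊂q⇒∣p∣<∣q∣ (chain zero))) growth)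
chain-growth {suc k} F chain (suc i) (suc j) (s≤s i≤j)
  with chain-growth (λ i → F (suc i)) (λ i → chain (suc i)) i j i≤j
... | Fi⊆Fj , growth = Fi⊆Fj ,
  ≤-trans (≤-reflexive (+-suc _ (toℕ j))) (≤-trans (s≤s growth) (≤-reflexive (sym (+-suc _ (toℕ i)))))

toℕ≤toℕ-fromℕ : (i : Fin (suc k)) → toℕ i ≤ toℕ (fromℕ k)
toℕ≤toℕ-fromℕ {k} i = subst (toℕ i ≤_) (sym (toℕ-fromℕ k)) (toℕ≤pred[n] i)

chain-⊆-top : (F : Fin (suc k) → Subset n) → StrictChain F → ∀ i → F i ⊆ F (fromℕ k)
chain-⊆-top F chain i = proj₁ (chain-growth F chain i _ (toℕ≤toℕ-fromℕ i))

chain-top-size : (F : Fin (suc k) → Subset n) → StrictChain F → k ≤ ∣ F (fromℕ k) ∣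
chain-top-size {k} F chain = begin
  k                                   ≤⟨ m≤n+m k _ ⟩
  ∣ F zero ∣ + k                      ≡⟨ cong (∣ F zero ∣ +_) (toℕ-fromℕ k) ⟨
  ∣ F zero ∣ + toℕ (fromℕ k)          ≤⟨ proj₂ (chain-growth F chain zero (fromℕ k) z≤n) ⟩
  ∣ F (fromℕ k) ∣ + 0                 ≡⟨ +-identityʳ _ ⟩
  ∣ F (fromℕ k) ∣                     ∎
  where open ≤-Reasoning

Bounded : (Fin k → Subset n) → Subset n → Set
Bounded F A = ∀ i → ∣ F i ∩ A ∣ ≤ toℕ i

Admissible : (m : ℕ) → (Fin (suc m) → Subset n) → Subset n → Set
Admissible m G A = ∣ A ∣ ≡ suc m × Bounded G A

bounded-∪⁅x⁆ : ∀ {F : Fin k → Subset n} {A x} → Bounded F A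
  → (∀ i → x ∈ F i → ∣ F i ∩ A ∣ < toℕ i) → Bounded F (A ∪ ⁅ x ⁆)
bounded-∪⁅x⁆ {F = F} {A} {x} bounded slack i with x ∈? F i
... | yes x∈Fi = ≤-trans (∣F∩[A∪⁅x⁆]∣ (F i) A x)
                   (≤-trans (+-monoʳ-≤ _ (≤-trans (∣p∩q∣≤∣q∣ (F i) ⁅ x ⁆) (≤-reflexive (∣⁅x⁆∣≡1 x))))
                     (≤-trans (≤-reflexive (+-comm _ 1)) (slack i x∈Fi)))
... | no  x∉Fi = ≤-trans (∣F∩[A∪⁅x⁆]∣ (F i) A x)
                   (≤-trans (≤-reflexive (trans (cong (_ +_) (∣p∩⁅x⁆∣≡0 x∉Fi)) (+-identityʳ _))) (bounded i))

-- An admissible set for the chain without its top set F_{m+1} is bounded for the whole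
-- chain: the new constraint |F_{m+1} ∩ A| ≤ m + 1 follows from |A| = m + 1.
bounded-extend : ∀ {m} (F : Fin (suc (suc m)) → Subset n) {A}
  → Admissible m (λ j → F (inject₁ j)) A → Bounded F A
bounded-extend {m = m} F {A} (size , bounded) i = byPosition (view i)
  where
  byPosition : ∀ {i} → View i → ∣ F i ∩ A ∣ ≤ toℕ i
  byPosition ‵fromℕ = ≤-trans (∣p∩q∣≤∣q∣ (F (fromℕ (suc m))) A)
                              (≤-reflexive (trans size (sym (toℕ-fromℕ (suc m)))))
  byPosition (‵inj₁ {i = j} _) = ≤-trans (bounded j) (≤-reflexive (sym (toℕ-inject₁ j)))

lastSatisfying : (P : Fin k → Set) → (∀ i → Dec (P i))
  → (∀ i → ¬ P i) ⊎ (∃ λ t → P t × (∀ i → toℕ t < toℕ i → ¬ P i))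
lastSatisfying {zero}  P P? = inj₁ (λ ())
lastSatisfying {suc k} P P? with lastSatisfying (λ i → P (suc i)) (λ i → P? (suc i))
... | inj₂ (t , pt , after) = inj₂ (suc t , pt , λ { zero () ; (suc i) (s≤s t<i) → after i t<i })
... | inj₁ none with P? zero
...   | yes p0 = inj₂ (zero , p0 , λ { zero () ; (suc i) _ → none i })
...   | no ¬p0 = inj₁ (λ { zero → ¬p0 ; (suc i) → none i })

-- If t is the last tight index
-- (|F_t ∩ A| = t), any d outside A ∪ F_t works, and |A ∪ F_t| ≤ |F_k| < n.
freshElement : (F : Fin (suc k) → Subset n) {A : Subset n} → StrictChain F → ∣ F (fromℕ k) ∣ < n
  → ∣ A ∣ ≡ k → Bounded F A → ∃ λ d → d ∉ A × (∀ i → d ∈ F i → ∣ F i ∩ A ∣ < toℕ i)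
freshElement {k} {n} F {A} chain top-small size bounded
  with lastSatisfying (λ i → ∣ F i ∩ A ∣ ≡ toℕ i) (λ i → ∣ F i ∩ A ∣ ≟ℕ toℕ i)
... | inj₁ noneTight with missedElement A (≤-<-trans (≤-trans (≤-reflexive size) (chain-top-size F chain)) top-small)
...   | d , d∉A = d , d∉A , λ i _ → ≤∧≢⇒< (bounded i) (noneTight i)
freshElement {k} {n} F {A} chain top-small size bounded
  | inj₂ (t , tight , laterSlack) with missedElement (A ∪ F t) (≤-<-trans ∣A∪Ft∣≤∣Fk∣ top-small)
  where
  ∣A∪Ft∣≤∣Fk∣ : ∣ A ∪ F t ∣ ≤ ∣ F (fromℕ k) ∣
  ∣A∪Ft∣≤∣Fk∣ = +-cancelʳ-≤ (toℕ t) _ _ (begin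
    ∣ A ∪ F t ∣ + toℕ t               ≡⟨ cong (∣ A ∪ F t ∣ +_) (trans (cong ∣_∣ (∩-comm A (F t))) tight) ⟨
    ∣ A ∪ F t ∣ + ∣ A ∩ F t ∣         ≡⟨ ∣p∪q∣+∣p∩q∣ A (F t) ⟩
    ∣ A ∣ + ∣ F t ∣                   ≡⟨ cong (_+ ∣ F t ∣) size ⟩
    k + ∣ F t ∣                       ≡⟨ +-comm k _ ⟩
    ∣ F t ∣ + k                       ≡⟨ cong (∣ F t ∣ +_) (toℕ-fromℕ k) ⟨
    ∣ F t ∣ + toℕ (fromℕ k)           ≤⟨ proj₂ (chain-growth F chain t (fromℕ k) (toℕ≤toℕ-fromℕ t)) ⟩
    ∣ F (fromℕ k) ∣ + toℕ t           ∎)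
    where open ≤-Reasoning
...   | d , d∉A∪Ft = d , (λ d∈A → d∉A∪Ft (x∈p∪q⁺ (inj₁ d∈A))) , slack
  where
  slack : ∀ i → d ∈ F i → ∣ F i ∩ A ∣ < toℕ i
  slack i d∈Fi with toℕ t <? toℕ i
  ... | yes t<i = ≤∧≢⇒< (bounded i) (laterSlack i t<i)
  ... | no  t≮i = contradiction (x∈p∪q⁺ (inj₂ (proj₁ (chain-growth F chain i t (≮⇒≥ t≮i)) d∈Fi))) d∉A∪Ft

module Extension {m : ℕ} (F : Fin (suc (suc m)) → Subset n) (chain : StrictChain F)
                 (g-small : ∣ F (fromℕ (suc m)) ∣ < n) where

  g : Subset n
  g = F (fromℕ (suc m))

  G : Fin (suc m) → Subset n
  G j = F (inject₁ j)

  G-chain : StrictChain G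
  G-chain j = chain (inject₁ j)

  G-small : ∣ G (fromℕ m) ∣ < n
  G-small = ≤-<-trans (p⊆q⇒∣p∣≤∣q∣ (chain-⊆-top F chain (inject₁ (fromℕ m)))) g-small

  addPoint : ∀ {A d} → Admissible m G A → d ∉ A → (∀ i → d ∈ F i → ∣ F i ∩ A ∣ < toℕ i)
    → Admissible (suc m) F (A ∪ ⁅ d ⁆)
  addPoint adm@(size , _) d∉A slack =
    trans (∣p∪⁅x⁆∣ d∉A) (cong suc size) , bounded-∪⁅x⁆ (bounded-extend F adm) slack

  -- An admissible set for G grows into an admissible set for F containing any given c ∉ g:
  -- add c itself if it is new, and a fresh point otherwise.
  augment : ∀ {A c} → Admissible m G A → c ∉ g
    → ∃ λ A′ → Admissible (suc m) F A′ × A ⊆ A′ × c ∈ A′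
  augment {A} {c} adm c∉g with c ∈? A
  ... | no c∉A = A ∪ ⁅ c ⁆ , addPoint adm c∉A (λ i c∈Fi → contradiction (chain-⊆-top F chain i c∈Fi) c∉g) ,
                 p⊆p∪q ⁅ c ⁆ , x∈p∪q⁺ (inj₂ (x∈⁅x⁆ c))
  ... | yes c∈A with freshElement F chain g-small (proj₁ adm) (bounded-extend F adm)
  ...   | d , d∉A , slack = A ∪ ⁅ d ⁆ , addPoint adm d∉A slack , p⊆p∪q ⁅ d ⁆ , x∈p∪q⁺ (inj₁ c∈A)

  shrink : ∀ {A′} → Admissible (suc m) F A′ → ∃ λ c → c ∈ A′ × c ∉ g × Admissible m G (A′ - c)
  shrink {A′} (size , bounded) with outsideElement g A′ g∩A′-small
    where
    g∩A′-small : ∣ g ∩ A′ ∣ < ∣ A′ ∣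
    g∩A′-small = ≤-trans (s≤s (bounded (fromℕ (suc m))))
                         (≤-reflexive (trans (cong suc (toℕ-fromℕ (suc m))) (sym size)))
  ... | c , c∈A′ , c∉g = c , c∈A′ , c∉g , suc-injective (trans (∣p-x∣ c∈A′) size) , boundedG
    where
    boundedG : Bounded G (A′ - c)
    boundedG j = ≤-trans (p⊆q⇒∣p∣≤∣q∣ Gj∩[A′-c]⊆Gj∩A′)
                         (≤-trans (bounded (inject₁ j)) (≤-reflexive (toℕ-inject₁ j)))
      where
      Gj∩[A′-c]⊆Gj∩A′ : G j ∩ (A′ - c) ⊆ G j ∩ A′
      Gj∩[A′-c]⊆Gj∩A′ x∈ with x∈p∩q⁻ (G j) _ x∈
      ... | x∈Gj , x∈A′-c = x∈p∩q⁺ (x∈Gj , p─q⊆p A′ ⁅ c ⁆ x∈A′-c)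

  exchange : ∀ I → (∃₂ λ A A₁ → Admissible m G A × SingletonOutside g A₁ × I ⊆ A ∪ A₁)
                 ⇔ (∃ λ A′ → Admissible (suc m) F A′ × I ⊆ A′)
  exchange I = mk⇔ grow cut
    where
    grow : (∃₂ λ A A₁ → Admissible m G A × SingletonOutside g A₁ × I ⊆ A ∪ A₁)
      → ∃ λ A′ → Admissible (suc m) F A′ × I ⊆ A′
    grow (A , _ , adm , (c , c∉g , refl) , I⊆A∪⁅c⁆) with augment adm c∉g
    ... | A′ , adm′ , A⊆A′ , c∈A′ = A′ , adm′ , I⊆A′
      where
      I⊆A′ : I ⊆ A′
      I⊆A′ x∈I with x∈p∪q⁻ A ⁅ c ⁆ (I⊆A∪⁅c⁆ x∈I)
      ... | inj₁ x∈A = A⊆A′ x∈A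
      ... | inj₂ x∈⁅c⁆ = subst (_∈ A′) (sym (x∈⁅y⁆⇒x≡y c x∈⁅c⁆)) c∈A′
    cut : (∃ λ A′ → Admissible (suc m) F A′ × I ⊆ A′)
      → ∃₂ λ A A₁ → Admissible m G A × SingletonOutside g A₁ × I ⊆ A ∪ A₁
    cut (A′ , adm′ , I⊆A′) with shrink adm′
    ... | c , c∈A′ , c∉g , adm = A′ - c , ⁅ c ⁆ , adm , (c , c∉g , refl) , I⊆[A′-c]∪⁅c⁆
      where
      I⊆[A′-c]∪⁅c⁆ : I ⊆ (A′ - c) ∪ ⁅ c ⁆
      I⊆[A′-c]∪⁅c⁆ {x} x∈I with x ≟ c
      ... | yes refl = x∈p∪q⁺ (inj₂ (x∈⁅x⁆ x))
      ... | no  x≢c  = x∈p∪q⁺ (inj₁ (x∈p∧x≢y⇒x∈p-y (I⊆A′ x∈I) x≢c))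

singletonAdmissible : ∀ (G : Fin 1 → Subset n) A → SingletonOutside (G zero) A ⇔ Admissible 0 G A
singletonAdmissible G A = mk⇔ singleton⇒admissible admissible⇒singleton
  where
  singleton⇒admissible : SingletonOutside (G zero) A → Admissible 0 G A
  singleton⇒admissible (c , c∉G₀ , refl) = ∣⁅x⁆∣≡1 c , λ { zero → ≤-reflexive (∣p∩⁅x⁆∣≡0 c∉G₀) }
  admissible⇒singleton : Admissible 0 G A → SingletonOutside (G zero) A
  admissible⇒singleton (size , bounded)
    with outsideElement (G zero) A (≤-trans (s≤s (bounded zero)) (≤-reflexive (sym size)))
  ... | c , c∈A , c∉G₀ = c , c∉G₀ , sym (⊆∧∣≡∣⇒≡ ⁅c⁆⊆A (trans (∣⁅x⁆∣≡1 c) (sym size)))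
    where
    ⁅c⁆⊆A : ⁅ c ⁆ ⊆ A
    ⁅c⁆⊆A x∈⁅c⁆ = subst (_∈ A) (sym (x∈⁅y⁆⇒x≡y c x∈⁅c⁆)) c∈A

-- In the inductive step the chain product is (M* ∨ H_g*)*, whose
-- cobases are the bases of M* ∨ H_g*, computed by exchange.
chainProduct-cobases : ∀ m (G : Fin (suc m) → Subset n) → StrictChain G → ∣ G (fromℕ m) ∣ < n
  → ∀ B → IsBasis (chainProduct m G) B ⇔ Admissible m G (∁ B)
chainProduct-cobases zero    G chain g-small B = singletonAdmissible G (∁ B) ∘⇔ H-cobases (G zero) g-small B
chainProduct-cobases (suc m) F chain g-small   = dualBases unionBases (λ _ → proj₁)
  where
  open Extension F chain g-small
  unionGenerators : Generates (union (dual (chainProduct m G)) (dual (H g))) (Admissible (suc m) F)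
  unionGenerators I = exchange I ∘⇔ unionGenerated
    (dualGenerated (chainProduct-cobases m G G-chain G-small)) (dualGenerated (H-cobases g g-small)) I
  unionBases : ∀ A → IsBasis (union (dual (chainProduct m G)) (dual (H g))) A ⇔ Admissible (suc m) F A
  unionBases = basesOfGenerated unionGenerators (λ _ → proj₁)

admissibleComplement : ∀ m (G : Fin (suc m) → Subset n) B → suc m ≤ n
  → Admissible m G (∁ B) ⇔ (∣ B ∣ ≡ n ∸ suc m × (∀ i → ∣ G i ─ B ∣ ≤ toℕ i))
admissibleComplement {n} m G B m<n = mk⇔
  (λ (size , bounded) → ∣∁p∣≡k⇒∣p∣≡n∸k B size ,
                        λ i → subst (_≤ toℕ i) (cong ∣_∣ (sym (p─q≡p∩∁q (G i) B))) (bounded i))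
  (λ (size , bounded) → trans (∣∁p∣≡n∸∣p∣ B) (trans (cong (n ∸_) size) (m∸[m∸n]≡n m<n)) ,
                        λ i → subst (_≤ toℕ i) (cong ∣_∣ (p─q≡p∩∁q (G i) B)) (bounded i))

lemma5p3 : (n : ℕ) → 2 ≤ n → (m : ℕ) → (G : Fin (suc m) → Subset n)
    → (∀ (i : Fin m) → G (inject₁ i) ⊂ G (suc i))
    → ∣ G (fromℕ m) ∣ ≤ n ∸ 2
    → (B : Subset n)
    → IsBasis (chainProduct m G) B
    ⇔ (∣ B ∣ ≡ n ∸ suc m × (∀ (i : Fin (suc m)) → ∣ G i ─ B ∣ ≤ toℕ i))
lemma5p3 n 2≤n m G chain top-bound B =
  admissibleComplement m G B m<n ∘⇔ chainProduct-cobases m G chain top-small B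
  where
  top-small : ∣ G (fromℕ m) ∣ < n
  top-small = ≤-<-trans top-bound (∸-monoʳ-< (s≤s z≤n) 2≤n)
  m<n : suc m ≤ n
  m<n = ≤-<-trans (chain-top-size G chain) top-small
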